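{- If $G$ is a cycle of order $n\geq 4$, then $mvd(G)=\left\lfloor \frac{n}{2}\right\rfloor$.
   Context: For a vertex-colored graph and two nonadjacent vertices $x,y$, an $x$-$y$ vertex cut is a set $S\subseteq V(G)\setminus\{x,y\}$ such that $x$ and $y$ lie in different components of $G-S$; it is monochromatic if all its vertices have the same color. A vertex-coloring is an MVD-coloring if every pair of nonadjacent vertices has a monochromatic vertex cut separating them. $mvd(G)$ is the maximum number of colors used by an MVD-coloring of $G$. -}

module Defs where

open import Data.Nat using (ℕ; zero; suc; _≤_; _/_)
open import Data.Fin using (Fin; toℕ)
open import Data.Product using (Σ; _×_; _,_)
open import Data.Sum using (_⊎_)
open import Data.Empty using (⊥)
open import Relation.Nullary using (¬_)
open import Relation.Binary.PropositionalEquality using (_≡_; _≢_)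
open import Function.Definitions using (Surjective)

Rel : ℕ → Set₁
Rel n = Fin n → Fin n → Set

CycleAdj : (n : ℕ) → Rel n
CycleAdj n i j =
  (toℕ j ≡ suc (toℕ i)) ⊎ (toℕ i ≡ suc (toℕ j)) ⊎
  ((toℕ i ≡ 0) × (suc (toℕ j) ≡ n)) ⊎ ((toℕ j ≡ 0) × (suc (toℕ i) ≡ n))

-- Connectivity in G - S: a walk from x whose every vertex after x
-- lies outside S (x itself is required outside S by the cut definition).
data ConnAvoid {n : ℕ} (Adj : Rel n) (S : Fin n → Set) (x : Fin n) : Fin n → Set where
  here : ConnAvoid Adj S x x
  step : ∀ {y z} → ConnAvoid Adj S x y → Adj y z → ¬ S z → ConnAvoid Adj S x z

IsVertexCut : {n : ℕ} (Adj : Rel n) (S : Fin n → Set) (x y : Fin n) → Set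
IsVertexCut Adj S x y = ¬ S x × ¬ S y × ¬ ConnAvoid Adj S x y

Monochromatic : {n k : ℕ} (c : Fin n → Fin k) (S : Fin n → Set) → Set
Monochromatic c S = ∀ u v → S u → S v → c u ≡ c v

IsMVDColoring : {n k : ℕ} (Adj : Rel n) (c : Fin n → Fin k) → Set₁
IsMVDColoring {n} Adj c =
  ∀ (x y : Fin n) → x ≢ y → ¬ Adj x y →
  Σ (Fin n → Set) λ S → IsVertexCut Adj S x y × Monochromatic c S

UsesAllColours : {n k : ℕ} (c : Fin n → Fin k) → Set
UsesAllColours c = Surjective _≡_ _≡_ c

MvdIs : {n : ℕ} (Adj : Rel n) (m : ℕ) → Set₁
MvdIs {n} Adj m =
  (Σ (Fin n → Fin m) λ c → IsMVDColoring Adj c × UsesAllColours c) ×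
  (∀ (k : ℕ) (c : Fin n → Fin k) → IsMVDColoring Adj c → UsesAllColours c → k ≤ m)

-- Lower bound: colour vertex i of C_n by i mod m, where m = ⌊n/2⌋.  Both
-- vertices of a pair {p, p+m} then get the same colour, and for any two
-- nonadjacent vertices some such pair has one of them strictly inside the arc
-- (p, p+m) and the other strictly outside, so it is a monochromatic cut.
-- Upper bound: in an MVD-colouring no colour is used only once.  If v were the
-- only vertex of its colour, a monochromatic cut between the two neighbours of
-- v would have to contain v (they are joined through v) and hence be {v}; but
-- C_n - v is still connected.  So every colour class has two vertices.
module Submission where

open import Defs
open import Data.Nat
  using (ℕ; zero; suc; _+_; _*_; _∸_; _≤_; _<_; _/_; _%_; z≤n; s≤s; NonZero; >-nonZero; _≤?_; _<?_)
open import Data.Nat.Properties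
open import Data.Nat.DivMod using (m%n<n; [m+n]%n≡m%n; m<n⇒m%n≡m; m/n*n≤m; /-monoˡ-≤; m*n/n≡m)
open import Data.Fin using (Fin; zero; suc; toℕ; fromℕ; fromℕ<; splitAt; join)
open import Data.Fin.Properties
  using (toℕ-injective; toℕ<n; toℕ-fromℕ; toℕ-fromℕ<; fromℕ<-cong; any?; injective⇒≤; join-splitAt)
  renaming (_≟_ to _≟ᶠ_; <⇒≢ to <⇒≢ᶠ)
open import Data.Product using (Σ; _×_; _,_; proj₁; proj₂)
open import Data.Sum using (_⊎_; inj₁; inj₂; [_,_]′)
open import Data.Empty using (⊥-elim)
open import Function using (_∘_)
open import Function.Definitions using (Surjective)
open import Relation.Nullary using (¬_; yes; no)
open import Relation.Nullary.Decidable using (_×-dec_; ¬?; decidable-stable)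
open import Relation.Binary.PropositionalEquality
open import Relation.Binary.Definitions using (tri<; tri≈; tri>)

module _ {n : ℕ} {Adj : Rel n} {S : Fin n → Set} where

  ConnAvoid-trans : ∀ {x y z} → ConnAvoid Adj S x y → ConnAvoid Adj S y z → ConnAvoid Adj S x z
  ConnAvoid-trans p here         = p
  ConnAvoid-trans p (step q a s) = step (ConnAvoid-trans p q) a s

  ConnAvoid-preserves : (P : Fin n → Set) → (∀ {z z'} → P z → Adj z z' → ¬ S z' → P z') →
                        ∀ {x y} → ConnAvoid Adj S x y → P x → P y
  ConnAvoid-preserves P closed here         px = px
  ConnAvoid-preserves P closed (step w a s) px = closed (ConnAvoid-preserves P closed w px) a s

descend : ∀ {n} {S : Fin n → Set} (d : ℕ) {x z : Fin n} → toℕ x ≡ toℕ z + d →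
          (∀ w → toℕ z ≤ toℕ w → toℕ w < toℕ x → ¬ S w) → ConnAvoid (CycleAdj n) S x z
descend zero {x} x≡z _ = subst (ConnAvoid _ _ x) (toℕ-injective (trans x≡z (+-identityʳ _))) here
descend {n} {S} (suc d) {x} {z} x≡z+1+d free =
  step (descend d x≡z₁+d free₁) (inj₂ (inj₁ (toℕ-fromℕ< z₁<n))) (free z ≤-refl z<x)
  where
    z<x : toℕ z < toℕ x
    z<x = subst (toℕ z <_) (sym x≡z+1+d) (m<m+n (toℕ z) (s≤s z≤n))
    z₁<n : suc (toℕ z) < n
    z₁<n = ≤-<-trans z<x (toℕ<n x)
    z₁ : Fin n
    z₁ = fromℕ< z₁<n
    x≡z₁+d : toℕ x ≡ toℕ z₁ + d
    x≡z₁+d = trans x≡z+1+d (trans (+-suc (toℕ z) d) (cong (_+ d) (sym (toℕ-fromℕ< z₁<n))))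
    free₁ : ∀ w → toℕ z₁ ≤ toℕ w → toℕ w < toℕ x → ¬ S w
    free₁ w z₁≤w = free w (≤-trans (n≤1+n _) (subst (_≤ toℕ w) (toℕ-fromℕ< z₁<n) z₁≤w))

Between : ℕ → ℕ → ℕ → Set
Between p q k = p < k × k < q

Beyond : ℕ → ℕ → ℕ → Set
Beyond p q k = k < p ⊎ q < k

Separates : ℕ → ℕ → ℕ → ℕ → Set
Separates p q a b = (Between p q a × Beyond p q b) ⊎ (Beyond p q a × Between p q b)

Separates-sym : ∀ {p q a b} → Separates p q a b → Separates p q b a
Separates-sym (inj₁ (a∈ , b∉)) = inj₂ (b∉ , a∈)
Separates-sym (inj₂ (a∉ , b∈)) = inj₁ (b∈ , a∉)

VertexPair : ∀ {n} → ℕ → ℕ → Fin n → Set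
VertexPair p q z = toℕ z ≡ p ⊎ toℕ z ≡ q

module _ {n p q : ℕ} (p<q : p < q) (q<n : q < n) where

  between-closed : ∀ {z z' : Fin n} → Between p q (toℕ z) → CycleAdj n z z' → ¬ VertexPair p q z' →
                   Between p q (toℕ z')
  between-closed (p<z , z<q) (inj₁ e) z'∉ =
    subst (p <_) (sym e) (≤-trans p<z (n≤1+n _)) , ≤∧≢⇒< (subst (_≤ q) (sym e) z<q) (z'∉ ∘ inj₂)
  between-closed (p<z , z<q) (inj₂ (inj₁ e)) z'∉ =
    ≤∧≢⇒< (≤-pred (subst (p <_) e p<z)) (z'∉ ∘ inj₁ ∘ sym) ,
    ≤-trans (n≤1+n _) (subst (λ t → suc t ≤ q) e z<q)
  between-closed (p<z , _) (inj₂ (inj₂ (inj₁ (z≡0 , _)))) _ with subst (p <_) z≡0 p<z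
  ... | ()
  between-closed {z} (_ , z<q) (inj₂ (inj₂ (inj₂ (_ , z+1≡n)))) _ =
    ⊥-elim (<⇒≱ (<-≤-trans (s≤s z<q) q<n) (subst (_≤ suc (toℕ z)) z+1≡n ≤-refl))

  beyond-closed : ∀ {z z' : Fin n} → Beyond p q (toℕ z) → CycleAdj n z z' → ¬ VertexPair p q z' →
                  Beyond p q (toℕ z')
  beyond-closed (inj₁ z<p) (inj₁ e) z'∉ = inj₁ (≤∧≢⇒< (subst (_≤ p) (sym e) z<p) (z'∉ ∘ inj₁))
  beyond-closed (inj₂ q<z) (inj₁ e) _ = inj₂ (subst (q <_) (sym e) (≤-trans q<z (n≤1+n _)))
  beyond-closed (inj₁ z<p) (inj₂ (inj₁ e)) _ = inj₁ (≤-trans (n≤1+n _) (subst (λ t → suc t ≤ p) e z<p))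
  beyond-closed (inj₂ q<z) (inj₂ (inj₁ e)) z'∉ =
    inj₂ (≤∧≢⇒< (≤-pred (subst (q <_) e q<z)) (z'∉ ∘ inj₂ ∘ sym))
  beyond-closed _ (inj₂ (inj₂ (inj₁ (_ , z'+1≡n)))) z'∉ =
    inj₂ (≤∧≢⇒< (≤-pred (subst (q <_) (sym z'+1≡n) q<n)) (z'∉ ∘ inj₂ ∘ sym))
  beyond-closed _ (inj₂ (inj₂ (inj₂ (z'≡0 , _)))) z'∉ =
    inj₁ (subst (_< p) (sym z'≡0) (≤∧≢⇒< z≤n (λ 0≡p → z'∉ (inj₁ (trans z'≡0 0≡p)))))

  between-∉-pair : ∀ {z : Fin n} → Between p q (toℕ z) → ¬ VertexPair p q z
  between-∉-pair (p<z , _) (inj₁ z≡p) = <⇒≢ p<z (sym z≡p)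
  between-∉-pair (_ , z<q) (inj₂ z≡q) = <⇒≢ z<q z≡q

  beyond-∉-pair : ∀ {z : Fin n} → Beyond p q (toℕ z) → ¬ VertexPair p q z
  beyond-∉-pair (inj₁ z<p) (inj₁ z≡p) = <⇒≢ z<p z≡p
  beyond-∉-pair (inj₁ z<p) (inj₂ z≡q) = <⇒≢ (<-trans z<p p<q) z≡q
  beyond-∉-pair (inj₂ q<z) (inj₁ z≡p) = <⇒≢ (<-trans p<q q<z) (sym z≡p)
  beyond-∉-pair (inj₂ q<z) (inj₂ z≡q) = <⇒≢ q<z (sym z≡q)

  between⇒¬beyond : ∀ {k} → Between p q k → ¬ Beyond p q k
  between⇒¬beyond (p<k , _) (inj₁ k<p) = <-asym p<k k<p
  between⇒¬beyond (_ , k<q) (inj₂ q<k) = <-asym k<q q<k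

  pair-cut : (x y : Fin n) → Separates p q (toℕ x) (toℕ y) → IsVertexCut (CycleAdj n) (VertexPair p q) x y
  pair-cut x y (inj₁ (x∈ , y∉)) =
    between-∉-pair x∈ , beyond-∉-pair y∉ ,
    λ walk → between⇒¬beyond (ConnAvoid-preserves (Between p q ∘ toℕ) between-closed walk x∈) y∉
  pair-cut x y (inj₂ (x∉ , y∈)) =
    beyond-∉-pair x∉ , between-∉-pair y∈ ,
    λ walk → between⇒¬beyond y∈ (ConnAvoid-preserves (Beyond p q ∘ toℕ) beyond-closed walk x∉)

window-start< : ∀ {m p t} → 2 ≤ m → p + m ≡ suc t → p < t
window-start< {m} {p} 2≤m p+m≡1+t =
  ≤-pred (subst (2 + p ≤_) p+m≡1+t (subst (_≤ p + m) (+-comm p 2) (+-monoʳ-≤ p 2≤m)))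

window-ending-at : ∀ {m t} → m ≤ t → Σ ℕ λ p → p + m ≡ t
window-ending-at {m} {t} m≤t = t ∸ m , m∸n+n≡m m≤t

-- The four cases place the window (p, p+m) so that it ends just after a,
-- starts just after a, ends just after b, or (when b = n-1) starts just before a.
window : ∀ {m n a b} → 2 ≤ m → m + m ≤ n → 2 + a ≤ b → b < n → (a ≡ 0 → suc b ≢ n) →
         Σ ℕ λ p → p + m < n × Separates p (p + m) a b
window {m} {n} {a} {b} 2≤m 2m≤n a+1<b b<n no-wrap with m ≤? suc a
... | yes m≤a+1 with window-ending-at m≤a+1
...   | p , p+m≡a+1 =
        p , subst (_< n) (sym p+m≡a+1) (<-trans a+1<b b<n) ,
        inj₁ ((window-start< 2≤m p+m≡a+1 , subst (a <_) (sym p+m≡a+1) ≤-refl) ,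
              inj₂ (subst (_< b) (sym p+m≡a+1) a+1<b))
window {m} {n} {a} {b} 2≤m 2m≤n a+1<b b<n no-wrap | no m≰a+1 with b <? suc a + m
... | yes b<a+1+m =
      suc a , <-≤-trans (+-monoˡ-< m (≰⇒> m≰a+1)) 2m≤n , inj₂ (inj₁ ≤-refl , a+1<b , b<a+1+m)
... | no b≮a+1+m with suc b <? n
...   | yes b+1<n with window-ending-at (≤-trans (m≤n+m m (suc a)) (≤-trans (≮⇒≥ b≮a+1+m) (n≤1+n b)))
...     | p , p+m≡b+1 =
          p , subst (_< n) (sym p+m≡b+1) b+1<n ,
          inj₂ (inj₁ a<p , window-start< 2≤m p+m≡b+1 , subst (b <_) (sym p+m≡b+1) ≤-refl)
  where
    a<p : a < p
    a<p = +-cancelʳ-< m a p (subst (a + m <_) (sym p+m≡b+1) (s≤s (≤-trans (n≤1+n _) (≮⇒≥ b≮a+1+m))))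
window {m} {n} {zero} {b} _ _ _ b<n no-wrap | no _ | no _ | no b+1≮n =
  ⊥-elim (no-wrap refl (≤-antisym b<n (≮⇒≥ b+1≮n)))
window {m} {n} {suc a} {b} 2≤m _ _ b<n _ | no _ | no b≮a+2+m | no _ =
  a , <-trans a+m<b b<n ,
  inj₁ ((≤-refl , subst (_≤ a + m) (+-comm a 2) (+-monoʳ-≤ a 2≤m)) , inj₂ a+m<b)
  where
    a+m<b : a + m < b
    a+m<b = ≤-trans (n≤1+n _) (≮⇒≥ b≮a+2+m)

module _ (m : ℕ) .{{_ : NonZero m}} where

  residue : ∀ {n} → Fin n → Fin m
  residue z = fromℕ< (m%n<n (toℕ z) m)

  residue-pair-monochromatic : ∀ {n} p → Monochromatic (residue {n}) (VertexPair p (p + m))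
  residue-pair-monochromatic p u v u∈ v∈ = trans (residue≡ u∈) (sym (residue≡ v∈))
    where
      residue≡ : ∀ {z} → VertexPair p (p + m) z → residue z ≡ fromℕ< (m%n<n p m)
      residue≡ (inj₁ z≡p)   = fromℕ<-cong _ _ (cong (_% m) z≡p) _ _
      residue≡ (inj₂ z≡p+m) = fromℕ<-cong _ _ (trans (cong (_% m) z≡p+m) ([m+n]%n≡m%n p m)) _ _

  module _ {n : ℕ} (2≤m : 2 ≤ m) (2m≤n : m + m ≤ n) where

    residue-cut : (x y : Fin n) → Σ ℕ (λ p → p + m < n × Separates p (p + m) (toℕ x) (toℕ y)) →
                  Σ (Fin n → Set) λ S → IsVertexCut (CycleAdj n) S x y × Monochromatic residue S
    residue-cut x y (p , p+m<n , sep) =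
      VertexPair p (p + m) ,
      pair-cut (m<m+n p (≤-trans (s≤s z≤n) 2≤m)) p+m<n x y sep ,
      residue-pair-monochromatic p

    residue-isMVD : IsMVDColoring (CycleAdj n) residue
    residue-isMVD x y x≢y x≁y with <-cmp (toℕ x) (toℕ y)
    ... | tri< x<y _ _ =
          residue-cut x y (window 2≤m 2m≤n (≤∧≢⇒< x<y (x≁y ∘ inj₁ ∘ sym)) (toℕ<n y)
                                  (λ x≡0 y+1≡n → x≁y (inj₂ (inj₂ (inj₁ (x≡0 , y+1≡n))))))
    ... | tri≈ _ x≡y _ = ⊥-elim (x≢y (toℕ-injective x≡y))
    ... | tri> _ _ y<x with window 2≤m 2m≤n (≤∧≢⇒< y<x (x≁y ∘ inj₂ ∘ inj₁ ∘ sym)) (toℕ<n x)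
                                (λ y≡0 x+1≡n → x≁y (inj₂ (inj₂ (inj₂ (y≡0 , x+1≡n)))))
    ...   | p , p+m<n , sep = residue-cut x y (p , p+m<n , Separates-sym sep)

    residue-surjective : Surjective _≡_ _≡_ (residue {n})
    residue-surjective j = fromℕ< j<n , λ { refl → toℕ-injective (begin
        toℕ (residue (fromℕ< j<n))   ≡⟨ toℕ-fromℕ< (m%n<n (toℕ (fromℕ< j<n)) m) ⟩
        toℕ (fromℕ< j<n) % m         ≡⟨ cong (_% m) (toℕ-fromℕ< j<n) ⟩
        toℕ j % m                    ≡⟨ m<n⇒m%n≡m (toℕ<n j) ⟩
        toℕ j                        ∎) }
      where
        open ≡-Reasoning
        j<n : toℕ j < n
        j<n = <-≤-trans (toℕ<n j) (≤-trans (m≤m+n m m) 2m≤n)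

module _ {n : ℕ} (Adj : Rel n) where

  record Bypass (v : Fin n) : Set₁ where
    field
      {x y}  : Fin n
      x≢y    : x ≢ y
      x≁y    : ¬ Adj x y
      x~v    : Adj x v
      v~y    : Adj v y
      detour : ∀ (S : Fin n → Set) → (∀ w → w ≢ v → ¬ S w) → ConnAvoid Adj S x y

SharesColour : ∀ {n k} → (Fin n → Fin k) → Fin n → Set
SharesColour {n} c v = Σ (Fin n) λ w → w ≢ v × c w ≡ c v

bypass⇒sharesColour : ∀ {n k} {Adj : Rel n} {c : Fin n → Fin k} → IsMVDColoring Adj c →
                      ∀ {v} → Bypass Adj v → SharesColour c v
bypass⇒sharesColour {c = c} mvd {v} bypass =
  decidable-stable (any? λ w → ¬? (w ≟ᶠ v) ×-dec (c w ≟ᶠ c v)) λ lonely →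
    let S , (x∉S , y∉S , cut) , mono = mvd x y x≢y x≁y
        v∉S : ¬ S v
        v∉S v∈S = cut (detour S λ w w≢v w∈S → lonely (w , w≢v , mono w v w∈S v∈S))
    in cut (step (step here x~v v∉S) v~y y∉S)
  where open Bypass bypass

sharesColour⇒k+k≤n : ∀ {n k} (c : Fin n → Fin k) → Surjective _≡_ _≡_ c → (∀ v → SharesColour c v) →
                     k + k ≤ n
sharesColour⇒k+k≤n {n} {k} c surj shares = injective⇒≤ {f = twoPerColour ∘ splitAt k} λ {i} {j} eq →
  trans (sym (join-splitAt k k i))
        (trans (cong (join k k) (twoPerColour-injective (splitAt k i) (splitAt k j) eq)) (join-splitAt k k j))
  where
    first second : Fin k → Fin n
    first j  = proj₁ (surj j)
    second j = proj₁ (shares (first j))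
    c-first : ∀ j → c (first j) ≡ j
    c-first j = proj₂ (surj j) refl
    c-second : ∀ j → c (second j) ≡ j
    c-second j = trans (proj₂ (proj₂ (shares (first j)))) (c-first j)
    second≢first : ∀ j → second j ≢ first j
    second≢first j = proj₁ (proj₂ (shares (first j)))
    twoPerColour : Fin k ⊎ Fin k → Fin n
    twoPerColour = [ first , second ]′
    twoPerColour-injective : ∀ a b → twoPerColour a ≡ twoPerColour b → a ≡ b
    twoPerColour-injective (inj₁ i) (inj₁ j) eq = cong inj₁ (trans (sym (c-first i)) (trans (cong c eq) (c-first j)))
    twoPerColour-injective (inj₂ i) (inj₂ j) eq = cong inj₂ (trans (sym (c-second i)) (trans (cong c eq) (c-second j)))
    twoPerColour-injective (inj₁ i) (inj₂ j) eq with trans (sym (c-first i)) (trans (cong c eq) (c-second j))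
    ... | refl = ⊥-elim (second≢first i (sym eq))
    twoPerColour-injective (inj₂ i) (inj₁ j) eq with trans (sym (c-second i)) (trans (cong c eq) (c-first j))
    ... | refl = ⊥-elim (second≢first i eq)

module _ (r : ℕ) where

  private
    last : Fin (4 + r)
    last = fromℕ (3 + r)

  bypass-first : ∀ {v : Fin (4 + r)} → toℕ v ≡ 0 → Bypass (CycleAdj (4 + r)) v
  bypass-first {v} v≡0 = record
    { x      = last
    ; y      = suc zero
    ; x≢y    = λ ()
    ; x≁y    = λ { (inj₁ ()) ; (inj₂ (inj₁ ()))
                 ; (inj₂ (inj₂ (inj₁ (() , _)))) ; (inj₂ (inj₂ (inj₂ (() , _)))) }
    ; x~v    = inj₂ (inj₂ (inj₂ (v≡0 , cong suc (toℕ-fromℕ (3 + r)))))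
    ; v~y    = inj₁ (cong suc (sym v≡0))
    ; detour = λ S free → descend (2 + r) (toℕ-fromℕ (3 + r)) λ w 1≤w _ →
                 free w (≢-sym (<⇒≢ᶠ (subst (_< toℕ w) (sym v≡0) 1≤w)))
    }

  bypass-last : ∀ {v : Fin (4 + r)} → toℕ v ≡ 3 + r → Bypass (CycleAdj (4 + r)) v
  bypass-last {v} v≡3+r = record
    { x      = x
    ; y      = zero
    ; x≢y    = λ ()
    ; x≁y    = λ { (inj₁ ()) ; (inj₂ (inj₁ ())) ; (inj₂ (inj₂ (inj₁ (() , _))))
                 ; (inj₂ (inj₂ (inj₂ (_ , x+1≡n)))) → 1+n≢n (sym (trans (cong suc (sym x≡2+r)) x+1≡n)) }
    ; x~v    = inj₁ (trans v≡3+r (cong suc (sym x≡2+r)))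
    ; v~y    = inj₂ (inj₂ (inj₂ (refl , cong suc v≡3+r)))
    ; detour = λ S free → descend (2 + r) x≡2+r λ w _ w<x →
                 free w (<⇒≢ᶠ (subst (toℕ w <_) (sym v≡3+r) (<-trans (subst (toℕ w <_) x≡2+r w<x) ≤-refl)))
    }
    where
      x<n : 2 + r < 4 + r
      x<n = s≤s (n≤1+n (2 + r))
      x : Fin (4 + r)
      x = fromℕ< x<n
      x≡2+r : toℕ x ≡ 2 + r
      x≡2+r = toℕ-fromℕ< x<n

  bypass-inner : ∀ {v : Fin (4 + r)} t → toℕ v ≡ suc t → 2 + t < 4 + r → Bypass (CycleAdj (4 + r)) v
  bypass-inner {v} t v≡1+t t+2<n = record
    { x      = x
    ; y      = y
    ; x≢y    = λ x≡y → m≢1+m+n t (trans (sym x≡t) (trans (cong toℕ x≡y) (trans y≡t+2 (cong suc (+-comm 1 t)))))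
    ; x≁y    = x≁y
    ; x~v    = inj₁ (trans v≡1+t (cong suc (sym x≡t)))
    ; v~y    = inj₁ (trans y≡t+2 (cong suc (sym v≡1+t)))
    ; detour = detour
    }
    where
      x<n : t < 4 + r
      x<n = <-trans (n<1+n t) (<-trans (n<1+n (suc t)) t+2<n)
      x : Fin (4 + r)
      x = fromℕ< x<n
      x≡t : toℕ x ≡ t
      x≡t = toℕ-fromℕ< x<n
      y : Fin (4 + r)
      y = fromℕ< t+2<n
      y≡t+2 : toℕ y ≡ 2 + t
      y≡t+2 = toℕ-fromℕ< t+2<n
      t+2≤3+r : 2 + t ≤ 3 + r
      t+2≤3+r = ≤-pred t+2<n

      x≁y : ¬ CycleAdj (4 + r) x y
      x≁y (inj₁ y≡x+1) = 1+n≢n (suc-injective (trans (sym y≡t+2) (trans y≡x+1 (cong suc x≡t))))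
      x≁y (inj₂ (inj₁ x≡y+1)) =
        m≢1+m+n t {2} (trans (sym x≡t) (trans x≡y+1 (cong suc (trans y≡t+2 (+-comm 2 t)))))
      x≁y (inj₂ (inj₂ (inj₁ (x≡0 , y+1≡n)))) with trans (sym x≡0) x≡t | trans (cong suc (sym y≡t+2)) y+1≡n
      ... | refl | ()
      x≁y (inj₂ (inj₂ (inj₂ (y≡0 , _)))) with trans (sym y≡t+2) y≡0
      ... | ()

      last≡y+d : toℕ last ≡ toℕ y + (3 + r ∸ (2 + t))
      last≡y+d = begin
        toℕ last                  ≡⟨ toℕ-fromℕ (3 + r) ⟩
        3 + r                     ≡⟨ m+[n∸m]≡n t+2≤3+r ⟨
        2 + t + (3 + r ∸ (2 + t)) ≡⟨ cong (_+ (3 + r ∸ (2 + t))) y≡t+2 ⟨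
        toℕ y + (3 + r ∸ (2 + t)) ∎
        where open ≡-Reasoning

      detour : ∀ S → (∀ w → w ≢ v → ¬ S w) → ConnAvoid (CycleAdj (4 + r)) S x y
      detour S free = ConnAvoid-trans (ConnAvoid-trans x→0 0→last) last→y
        where
          x→0 : ConnAvoid (CycleAdj (4 + r)) S x zero
          x→0 = descend t x≡t λ w _ w<x →
            free w (<⇒≢ᶠ (subst (toℕ w <_) (sym v≡1+t) (≤-trans (subst (toℕ w <_) x≡t w<x) (n≤1+n t))))
          0→last : ConnAvoid (CycleAdj (4 + r)) S zero last
          0→last = step here (inj₂ (inj₂ (inj₁ (refl , cong suc (toℕ-fromℕ (3 + r))))))
                        (free last (≢-sym (<⇒≢ᶠ (subst₂ _<_ (sym v≡1+t) (sym (toℕ-fromℕ (3 + r))) t+2≤3+r))))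
          last→y : ConnAvoid (CycleAdj (4 + r)) S last y
          last→y = descend (3 + r ∸ (2 + t)) last≡y+d λ w y≤w _ →
            free w (≢-sym (<⇒≢ᶠ (subst (_< toℕ w) (sym v≡1+t) (subst (_≤ toℕ w) y≡t+2 y≤w))))

  cycle-bypass : (v : Fin (4 + r)) → Bypass (CycleAdj (4 + r)) v
  cycle-bypass v with toℕ v in v≡
  ... | zero = bypass-first v≡
  ... | suc t with 2 + t <? 4 + r
  ...   | yes t+2<n = bypass-inner t v≡ t+2<n
  ...   | no t+2≮n  =
          bypass-last (trans v≡ (suc-injective (≤-antisym (subst (_< 4 + r) v≡ (toℕ<n v)) (≮⇒≥ t+2≮n))))

k+k≡k*2 : ∀ k → k + k ≡ k * 2
k+k≡k*2 k = trans (cong (k +_) (sym (+-identityʳ k))) (*-comm 2 k)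

k+k≤n⇒k≤n/2 : ∀ {k n} → k + k ≤ n → k ≤ n / 2
k+k≤n⇒k≤n/2 {k} {n} k+k≤n = subst (_≤ n / 2) (m*n/n≡m k 2) (/-monoˡ-≤ 2 (subst (_≤ n) (k+k≡k*2 k) k+k≤n))

n/2+n/2≤n : ∀ n → n / 2 + n / 2 ≤ n
n/2+n/2≤n n = subst (_≤ n) (sym (k+k≡k*2 (n / 2))) (m/n*n≤m n 2)

lemma2p4 : (n : ℕ) → 4 ≤ n → MvdIs (CycleAdj n) (n / 2)
lemma2p4 n@(suc (suc (suc (suc r)))) 4≤n@(s≤s (s≤s (s≤s (s≤s _)))) =
  (residue (n / 2) {{half≢0}} , residue-isMVD (n / 2) {{half≢0}} 2≤half (n/2+n/2≤n n)
                              , residue-surjective (n / 2) {{half≢0}} 2≤half (n/2+n/2≤n n)) ,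
  λ k c isMVD surj →
    k+k≤n⇒k≤n/2 (sharesColour⇒k+k≤n c surj λ v → bypass⇒sharesColour isMVD (cycle-bypass r v))
  where
    2≤half : 2 ≤ n / 2
    2≤half = /-monoˡ-≤ {4} {n} 2 4≤n
    half≢0 : NonZero (n / 2)
    half≢0 = >-nonZero (≤-trans (s≤s z≤n) 2≤half)
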